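{- For all $a,b\in\mathbb{N}\cup\{0\}$ and $m\in\mathbb{N}$, there is a constant $\Upsilon=\Upsilon(a,b,m)\in\mathbb{N}$ with the following property. Let $G$ be a graph and let $\mathcal{B}_1,\dots,\mathcal{B}_m$ be collections of pairwise disjoint $a$-pairs over $V(G)$, each of cardinality at least $\Upsilon$. Then for every $i\in\{1,\dots,m\}$ there exists $\mathcal{B}'_i\subseteq\mathcal{B}_i$ with $|\mathcal{B}'_i|\ge b$ such that for all distinct $i,j\in\{1,\dots,m\}$: (a) $A_i\cap B_j=\emptyset$ for all $(A_i,B_i)\in\mathcal{B}'_i$ and $(A_j,B_j)\in\mathcal{B}'_j$; and (b) either $A_i$ is anticomplete to $B_j$ in $G$ for all $(A_i,B_i)\in\mathcal{B}'_i$ and $(A_j,B_j)\in\mathcal{B}'_j$, or for every $(A_i,B_i)\in\mathcal{B}'_i$ there exists $x_i\in A_i$ such that $x_i$ has a neighbor in $B_j$ for every $(A_j,B_j)\in\mathcal{B}'_j$.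
   Context: For a set $U$ and $a\in\mathbb{N}\cup\{0\}$, an $a$-pair over $U$ is a pair $(A,B)$ of subsets of $U$ with $|A|\le a$. Two $a$-pairs $(A,B),(A',B')$ are disjoint if $B\cap B'=\emptyset$. Sets $X,Y\subseteq V(G)$ are anticomplete if there is no edge with one end in $X$ and the other in $Y$. -}

module Defs where

open import Data.Nat using (ℕ; _≤_)
open import Data.Bool using (Bool; true; false)
open import Data.Fin using (Fin)
open import Data.Fin.Subset using (Subset; _∈_; _∩_; Empty; ∣_∣)
open import Data.Product using (_×_; Σ; ∃; _,_; proj₁; proj₂)
open import Data.Sum using (_⊎_)
open import Relation.Binary.PropositionalEquality using (_≡_; _≢_)
open import Function.Definitions using (Injective)

record Graph (n : ℕ) : Set where
  field
    adj   : Fin n → Fin n → Bool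
    sym   : ∀ x y → adj x y ≡ adj y x
    irrefl : ∀ x → adj x x ≡ false
open Graph public

Pair : ℕ → Set
Pair n = Subset n × Subset n

fstP : ∀ {n} → Pair n → Subset n
fstP = proj₁

sndP : ∀ {n} → Pair n → Subset n
sndP = proj₂

IsAPair : ∀ {n} → ℕ → Pair n → Set
IsAPair a p = ∣ fstP p ∣ ≤ a

DisjointSets : ∀ {n} → Subset n → Subset n → Set
DisjointSets X Y = Empty (X ∩ Y)

DisjointPairs : ∀ {n} → Pair n → Pair n → Set
DisjointPairs p q = DisjointSets (sndP p) (sndP q)

IsDisjointAPairCollection : ∀ {n k} → ℕ → (Fin k → Pair n) → Set
IsDisjointAPairCollection {k = k} a 𝓑 =
  Injective _≡_ _≡_ 𝓑
  × (∀ p → IsAPair a (𝓑 p))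
  × (∀ p q → p ≢ q → DisjointPairs (𝓑 p) (𝓑 q))

Anticomplete : ∀ {n} → Graph n → Subset n → Subset n → Set
Anticomplete G X Y = ∀ x y → x ∈ X → y ∈ Y → adj G x y ≡ false

HasNeighbourIn : ∀ {n} → Graph n → Fin n → Subset n → Set
HasNeighbourIn G x Y = ∃ λ y → y ∈ Y × adj G x y ≡ true

-- A vertex x lies in at most one B of a disjoint family, and after discarding that one,
-- halving the family by "x has a neighbour in B" leaves a large part on which x behaves
-- uniformly. Repeating this for the at most a vertices of A gives, for a single a-pair
-- (A, _), a large subfamily of B's that A either avoids and is anticomplete to, or avoids
-- and sees through one vertex. Repeating it for 2s pairs of a second collection and then
-- halving those pairs by which alternative holds separates one ordered pair of collections;
-- finally all ordered pairs are treated in turn, each step only shrinking the collections.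
module Submission where

open import Defs hiding (sym)
open import Data.Bool using (true; false)
import Data.Bool as Bool
open import Data.Bool.Properties using (¬-not)
open import Data.Empty using (⊥-elim)
open import Data.Fin using (Fin; zero; suc; _≟_)
open import Data.Fin.Properties using (any?; all?)
open import Data.Fin.Subset
  using (Subset; _∈_; _∉_; _⊆_; _∩_; ∁; ∣_∣; ⊤; ⊥; ⁅_⁆; Lift; outside; inside)
open import Data.Fin.Subset.Properties
  using ( _∈?_; Lift?; nonempty?; Empty-unique; ∣⊥∣≡0; ∣⊤∣≡n; x∈⁅x⁆; ∣⁅x⁆∣≡1; ∉⊥
        ; p⊆q⇒∣p∣≤∣q∣; out⊆; in⊆in; p∩q⊆p; p∩q⊆q; x∈p∩q⁺; x∈p∩q⁻; x∈∁p⇒x∉p)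
open import Data.List using (List; []; _∷_; length; cartesianProduct; allFin)
open import Data.List.Membership.Propositional.Properties using (∈-cartesianProduct⁺; ∈-allFin)
open import Data.List.Relation.Unary.All using (All; []; _∷_)
import Data.List.Relation.Unary.All as All
open import Data.Nat using (ℕ; zero; suc; _+_; _∸_; _≤_; _≤?_; z≤n; s≤s; s≤s⁻¹)
open import Data.Nat.GeneralisedArithmetic using (fold; fold-+)
open import Data.Nat.Properties
  using (≤-refl; ≤-reflexive; ≤-trans; <⇒≤; ≰⇒>; +-suc; +-monoˡ-≤; +-cancelˡ-≤; m≤m+n; m≤n+m;
         n≤1+n; m∸n+n≡m; module ≤-Reasoning)
open import Data.Product using (_×_; Σ; ∃; ∃₂; _,_; proj₁; proj₂; uncurry)
open import Data.Sum using (_⊎_; inj₁; inj₂)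
open import Data.Vec using (tabulate; []; _∷_; here; there)
open import Data.Vec.Properties using (lookup∘tabulate; lookup⇒[]=; []=⇒lookup)
open import Function using (_∘_)
open import Relation.Binary.PropositionalEquality
  using (_≡_; _≢_; refl; sym; trans; cong; subst; subst₂)
open import Relation.Nullary using (¬_; Dec; yes; no; does)
open import Relation.Nullary.Decidable using (_×-dec_; _→-dec_; dec-true)
open import Relation.Unary using (Decidable)

private
  variable
    n K L : ℕ

m+m≤n+o⇒m≤n⊎m≤o : ∀ {m n o} → m + m ≤ n + o → m ≤ n ⊎ m ≤ o
m+m≤n+o⇒m≤n⊎m≤o {m} {n} {o} le with m ≤? n
... | yes m≤n = inj₁ m≤n
... | no m≰n = inj₂ (+-cancelˡ-≤ m m o (≤-trans le (+-monoˡ-≤ o (<⇒≤ (≰⇒> m≰n)))))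

fold-inflationary : ∀ {h : ℕ → ℕ} → (∀ N → N ≤ h N) → ∀ e N → N ≤ fold N h e
fold-inflationary infl zero    N = ≤-refl
fold-inflationary infl (suc e) N = ≤-trans (fold-inflationary infl e N) (infl _)

fold-monoʳ-≤ : ∀ {h : ℕ → ℕ} → (∀ N → N ≤ h N) → ∀ {e e′} N → e ≤ e′ → fold N h e ≤ fold N h e′
fold-monoʳ-≤ {h} infl {e} {e′} N e≤e′ =
  subst (fold N h e ≤_)
        (trans (sym (fold-+ N h (e′ ∸ e))) (cong (fold N h) (m∸n+n≡m e≤e′)))
        (fold-inflationary infl (e′ ∸ e) (fold N h e))

satisfying : ∀ {P : Fin K → Set} → Decidable P → Subset K
satisfying P? = tabulate (λ x → does (P? x))

module _ {P : Fin K → Set} (P? : Decidable P) where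

  ∈satisfying⁺ : ∀ {x} → P x → x ∈ satisfying P?
  ∈satisfying⁺ {x} px = lookup⇒[]= x _ (trans (lookup∘tabulate _ x) (dec-true (P? x) px))

  ∈satisfying⁻ : ∀ {x} → x ∈ satisfying P? → P x
  ∈satisfying⁻ {x} x∈ with P? x | trans (sym (lookup∘tabulate _ x)) ([]=⇒lookup x∈)
  ... | yes px | _  = px
  ... | no _   | ()

  ∈∁satisfying⁻ : ∀ {x} → x ∈ ∁ (satisfying P?) → ¬ P x
  ∈∁satisfying⁻ x∈ px = x∈∁p⇒x∉p x∈ (∈satisfying⁺ px)

∣p∩q∣+∣p∩∁q∣≡∣p∣ : ∀ (p q : Subset K) → ∣ p ∩ q ∣ + ∣ p ∩ ∁ q ∣ ≡ ∣ p ∣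
∣p∩q∣+∣p∩∁q∣≡∣p∣ []            []            = refl
∣p∩q∣+∣p∩∁q∣≡∣p∣ (outside ∷ p) (_ ∷ q)       = ∣p∩q∣+∣p∩∁q∣≡∣p∣ p q
∣p∩q∣+∣p∩∁q∣≡∣p∣ (inside ∷ p)  (inside ∷ q)  = cong suc (∣p∩q∣+∣p∩∁q∣≡∣p∣ p q)
∣p∩q∣+∣p∩∁q∣≡∣p∣ (inside ∷ p)  (outside ∷ q) =
  trans (+-suc ∣ p ∩ q ∣ ∣ p ∩ ∁ q ∣) (cong suc (∣p∩q∣+∣p∩∁q∣≡∣p∣ p q))

∣p∣≤1 : ∀ (p : Subset K) → (∀ {x y} → x ∈ p → y ∈ p → x ≡ y) → ∣ p ∣ ≤ 1
∣p∣≤1 {K} p unique with nonempty? p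
... | yes (x , x∈p) =
  ≤-trans (p⊆q⇒∣p∣≤∣q∣ (λ y∈p → subst (_∈ ⁅ x ⁆) (unique x∈p y∈p) (x∈⁅x⁆ x)))
          (≤-reflexive (∣⁅x⁆∣≡1 x))
... | no p-empty =
  ≤-trans (≤-reflexive (trans (cong ∣_∣ (Empty-unique p-empty)) (∣⊥∣≡0 K))) z≤n

⊆-ofSize : ∀ c (p : Subset K) → c ≤ ∣ p ∣ → ∃ λ q → q ⊆ p × ∣ q ∣ ≡ c
⊆-ofSize {K} zero    p             _        = ⊥ , (λ x∈⊥ → ⊥-elim (∉⊥ x∈⊥)) , ∣⊥∣≡0 K
⊆-ofSize     (suc c) (outside ∷ p) c<∣p∣    =
  let q , q⊆p , ∣q∣≡c = ⊆-ofSize (suc c) p c<∣p∣ in outside ∷ q , out⊆ q⊆p , ∣q∣≡c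
⊆-ofSize     (suc c) (inside ∷ p)  (s≤s c≤) =
  let q , q⊆p , ∣q∣≡c = ⊆-ofSize c p c≤ in inside ∷ q , in⊆in q⊆p , cong suc ∣q∣≡c

Lift-⊆ : ∀ {P : Fin K → Set} {Q Q′} → Q′ ⊆ Q → Lift P Q → Lift P Q′
Lift-⊆ Q′⊆Q all = all ∘ Q′⊆Q

-- Refining a subset to a large subset with a given property

Hereditary : (Subset K → Set) → Set
Hereditary G = ∀ {Q Q′} → Q′ ⊆ Q → G Q → G Q′

Refinable : (ℕ → ℕ) → (Subset K → Set) → Set
Refinable {K} cost G = ∀ N (Q : Subset K) → cost N ≤ ∣ Q ∣ → ∃ λ Q′ → Q′ ⊆ Q × N ≤ ∣ Q′ ∣ × G Q′

refinable-map : ∀ {cost} {G G′ : Subset K → Set} →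
  (∀ {Q} → G Q → G′ Q) → Refinable cost G → Refinable cost G′
refinable-map G⇒G′ refine N Q large =
  let Q′ , Q′⊆Q , N≤ , g = refine N Q large in Q′ , Q′⊆Q , N≤ , G⇒G′ g

refinable-cost : ∀ {cost cost′} {G : Subset K → Set} →
  (∀ N → cost N ≤ cost′ N) → Refinable cost G → Refinable cost′ G
refinable-cost cost≤cost′ refine N Q large = refine N Q (≤-trans (cost≤cost′ N) large)

refinable-⋂ : ∀ {r} {h : ℕ → ℕ} (G : Fin r → Subset K → Set) →
  (∀ t → Hereditary (G t)) → (∀ t → Refinable h (G t)) →
  ∀ v → Refinable (λ N → fold N h ∣ v ∣) (λ Q → Lift (λ t → G t Q) v)
refinable-⋂ G hered refine [] N Q large = Q , (λ x∈ → x∈) , large , λ ()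
refinable-⋂ G hered refine (outside ∷ v) N Q large =
  let Q′ , Q′⊆Q , N≤ , good = refinable-⋂ (G ∘ suc) (hered ∘ suc) (refine ∘ suc) v N Q large
  in Q′ , Q′⊆Q , N≤ , λ { (there t∈v) → good t∈v }
refinable-⋂ {h = h} G hered refine (inside ∷ v) N Q large =
  let Q₁ , Q₁⊆Q , Q₁-large , good₀ = refine zero (fold N h ∣ v ∣) Q large
      Q′ , Q′⊆Q₁ , N≤ , good = refinable-⋂ (G ∘ suc) (hered ∘ suc) (refine ∘ suc) v N Q₁ Q₁-large
  in Q′ , Q₁⊆Q ∘ Q′⊆Q₁ , N≤ , λ { here → hered zero Q′⊆Q₁ good₀ ; (there t∈v) → good t∈v }

Homogeneous : (Fin K → Set) → Subset K → Set
Homogeneous P Q = Lift P Q ⊎ Lift (¬_ ∘ P) Q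

Homogeneous-⊆ : ∀ {P : Fin K → Set} → Hereditary (Homogeneous P)
Homogeneous-⊆ Q′⊆Q (inj₁ all)  = inj₁ (Lift-⊆ Q′⊆Q all)
Homogeneous-⊆ Q′⊆Q (inj₂ none) = inj₂ (Lift-⊆ Q′⊆Q none)

refinable-homogeneous : ∀ {P : Fin K → Set} → Decidable P → Refinable (λ N → N + N) (Homogeneous P)
refinable-homogeneous {K} {P} P? N Q large =
  choose (m+m≤n+o⇒m≤n⊎m≤o (subst (N + N ≤_) (sym (∣p∩q∣+∣p∩∁q∣≡∣p∣ Q S)) large))
  where
  S : Subset K
  S = satisfying P?

  choose : N ≤ ∣ Q ∩ S ∣ ⊎ N ≤ ∣ Q ∩ ∁ S ∣ → ∃ λ Q′ → Q′ ⊆ Q × N ≤ ∣ Q′ ∣ × Homogeneous P Q′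
  choose (inj₁ N≤) = Q ∩ S , p∩q⊆p Q S , N≤ , inj₁ (∈satisfying⁻ P? ∘ p∩q⊆q Q S)
  choose (inj₂ N≤) = Q ∩ ∁ S , p∩q⊆p Q (∁ S) , N≤ , inj₂ (∈∁satisfying⁻ P? ∘ p∩q⊆q Q (∁ S))

hasNeighbourIn? : (G : Graph n) → ∀ x Y → Dec (HasNeighbourIn G x Y)
hasNeighbourIn? G x Y = any? λ y → (y ∈? Y) ×-dec (adj G x y Bool.≟ true)

anticomplete? : (G : Graph n) → ∀ X Y → Dec (Anticomplete G X Y)
anticomplete? G X Y = all? λ x → all? λ y → (x ∈? X) →-dec ((y ∈? Y) →-dec (adj G x y Bool.≟ false))

neighbourless⇒anticomplete : (G : Graph n) {X Y : Subset n} →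
  Lift (λ x → ¬ HasNeighbourIn G x Y) X → Anticomplete G X Y
neighbourless⇒anticomplete G none x y x∈X y∈Y = ¬-not λ xy → none x∈X (y , y∈Y , xy)

Separated : Graph n → (Fin K → Subset n) → (Fin L → Subset n) → Subset K → Subset L → Set
Separated G 𝓐 𝓑 P Q =
  (∀ p q → p ∈ P → q ∈ Q → DisjointSets (𝓐 p) (𝓑 q))
  ×
  ((∀ p q → p ∈ P → q ∈ Q → Anticomplete G (𝓐 p) (𝓑 q))
   ⊎
   (∀ p → p ∈ P → ∃ λ x → x ∈ 𝓐 p × (∀ q → q ∈ Q → HasNeighbourIn G x (𝓑 q))))

separated-antitone : ∀ {G : Graph n} {𝓐 : Fin K → Subset n} {𝓑 : Fin L → Subset n} {P P′ Q Q′} →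
  P′ ⊆ P → Q′ ⊆ Q → Separated G 𝓐 𝓑 P Q → Separated G 𝓐 𝓑 P′ Q′
separated-antitone P′⊆P Q′⊆Q (disjoint , inj₁ anti) =
  (λ p q p∈ q∈ → disjoint p q (P′⊆P p∈) (Q′⊆Q q∈)) ,
  inj₁ (λ p q p∈ q∈ → anti p q (P′⊆P p∈) (Q′⊆Q q∈))
separated-antitone P′⊆P Q′⊆Q (disjoint , inj₂ seen) =
  (λ p q p∈ q∈ → disjoint p q (P′⊆P p∈) (Q′⊆Q q∈)) ,
  inj₂ (λ p p∈ → let x , x∈ , sees = seen p (P′⊆P p∈) in x , x∈ , λ q q∈ → sees q (Q′⊆Q q∈))

-- Separating one collection of a-pairs from a disjoint family

uniformCost : ℕ → ℕ
uniformCost N = suc (N + N)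

uniformCost-inflationary : ∀ N → N ≤ uniformCost N
uniformCost-inflationary N = ≤-trans (m≤m+n N N) (n≤1+n _)

dichotomyCost : ℕ → ℕ → ℕ
dichotomyCost a N = fold N uniformCost a

-- 2s indices of the first collection are kept, and the second one must survive a
-- dichotomy refinement for each of them.
pairCost : ℕ → ℕ → ℕ
pairCost a s = s + s + fold s (dichotomyCost a) (s + s)

pairCost-inflationary : ∀ a s → s ≤ pairCost a s
pairCost-inflationary a s = ≤-trans (m≤m+n s s) (m≤m+n _ _)

module Separation (G : Graph n) (𝓑 : Fin K → Subset n)
  (𝓑-disjoint : ∀ q q′ → q ≢ q′ → DisjointSets (𝓑 q) (𝓑 q′)) where

  Uniform : Fin n → Subset K → Set
  Uniform x Q = Lift (λ q → x ∉ 𝓑 q) Q × Homogeneous (λ q → HasNeighbourIn G x (𝓑 q)) Q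

  uniform-hereditary : ∀ x → Hereditary (Uniform x)
  uniform-hereditary x Q′⊆Q (avoids , hom) = Lift-⊆ Q′⊆Q avoids , Homogeneous-⊆ Q′⊆Q hom

  uniform-refinable : ∀ x → Refinable uniformCost (Uniform x)
  uniform-refinable x N Q large =
    let Q′ , Q′⊆ , N≤ , hom = refinable-homogeneous (λ q → hasNeighbourIn? G x (𝓑 q)) N (Q ∩ ∁ S) 2N≤
    in Q′ , p∩q⊆p Q (∁ S) ∘ Q′⊆ , N≤ , ∈∁satisfying⁻ (λ q → x ∈? 𝓑 q) ∘ p∩q⊆q Q (∁ S) ∘ Q′⊆ , hom
    where
    S : Subset K
    S = satisfying (λ q → x ∈? 𝓑 q)

    unique : ∀ {q q′} → q ∈ Q ∩ S → q′ ∈ Q ∩ S → q ≡ q′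
    unique {q} {q′} q∈ q′∈ with q ≟ q′
    ... | yes q≡q′ = q≡q′
    ... | no q≢q′ = ⊥-elim (𝓑-disjoint q q′ q≢q′ (x , x∈p∩q⁺ (member q∈ , member q′∈)))
      where
      member : ∀ {q} → q ∈ Q ∩ S → x ∈ 𝓑 q
      member = ∈satisfying⁻ (λ q → x ∈? 𝓑 q) ∘ p∩q⊆q Q S

    2N≤ : N + N ≤ ∣ Q ∩ ∁ S ∣
    2N≤ = s≤s⁻¹ (begin
      suc (N + N)               ≤⟨ large ⟩
      ∣ Q ∣                     ≡⟨ sym (∣p∩q∣+∣p∩∁q∣≡∣p∣ Q S) ⟩
      ∣ Q ∩ S ∣ + ∣ Q ∩ ∁ S ∣   ≤⟨ +-monoˡ-≤ _ (∣p∣≤1 (Q ∩ S) unique) ⟩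
      suc ∣ Q ∩ ∁ S ∣           ∎)
      where open ≤-Reasoning

  SeesAll : Fin n → Subset K → Set
  SeesAll x Q = Lift (λ q → HasNeighbourIn G x (𝓑 q)) Q

  AnticompleteToAll : Subset n → Subset K → Set
  AnticompleteToAll A Q = Lift (λ q → Anticomplete G A (𝓑 q)) Q

  Dichotomy : Subset n → Subset K → Set
  Dichotomy A Q =
    Lift (λ q → DisjointSets A (𝓑 q)) Q ×
    (AnticompleteToAll A Q ⊎ ∃ λ x → x ∈ A × SeesAll x Q)

  dichotomy-hereditary : ∀ A → Hereditary (Dichotomy A)
  dichotomy-hereditary A Q′⊆Q (disjoint , inj₁ anti) = Lift-⊆ Q′⊆Q disjoint , inj₁ (Lift-⊆ Q′⊆Q anti)
  dichotomy-hereditary A Q′⊆Q (disjoint , inj₂ (x , x∈A , sees)) =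
    Lift-⊆ Q′⊆Q disjoint , inj₂ (x , x∈A , Lift-⊆ Q′⊆Q sees)

  uniform⇒dichotomy : ∀ A {Q} → Lift (λ x → Uniform x Q) A → Dichotomy A Q
  uniform⇒dichotomy A {Q} uniform =
    disjoint , decide (any? λ x → (x ∈? A) ×-dec Lift? (λ q → hasNeighbourIn? G x (𝓑 q)) Q)
    where
    disjoint : Lift (λ q → DisjointSets A (𝓑 q)) Q
    disjoint q∈Q (x , x∈A∩𝓑q) =
      let x∈A , x∈𝓑q = x∈p∩q⁻ A (𝓑 _) x∈A∩𝓑q in proj₁ (uniform x∈A) q∈Q x∈𝓑q

    decide : Dec (∃ λ x → x ∈ A × SeesAll x Q) →
             AnticompleteToAll A Q ⊎ ∃ λ x → x ∈ A × SeesAll x Q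
    decide (yes sees) = inj₂ sees
    decide (no ¬sees) = inj₁ λ q∈Q → neighbourless⇒anticomplete G (λ x∈A → silent x∈A q∈Q)
      where
      silent : ∀ {x q} → x ∈ A → q ∈ Q → ¬ HasNeighbourIn G x (𝓑 q)
      silent x∈A q∈Q with proj₂ (uniform x∈A)
      ... | inj₁ sees = ⊥-elim (¬sees (_ , x∈A , sees))
      ... | inj₂ none = none q∈Q

  dichotomy-refinable : ∀ {a} A → ∣ A ∣ ≤ a → Refinable (dichotomyCost a) (Dichotomy A)
  dichotomy-refinable A ∣A∣≤a =
    refinable-cost (λ N → fold-monoʳ-≤ uniformCost-inflationary N ∣A∣≤a)
      (refinable-map (uniform⇒dichotomy A)
        (refinable-⋂ Uniform uniform-hereditary uniform-refinable A))

  vertex-of-dichotomy : ∀ {A Q} → ¬ AnticompleteToAll A Q → Dichotomy A Q → ∃ λ x → x ∈ A × SeesAll x Q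
  vertex-of-dichotomy ¬anti (_ , inj₁ anti) = ⊥-elim (¬anti anti)
  vertex-of-dichotomy ¬anti (_ , inj₂ sees) = sees

  separated : ∀ {𝓐 : Fin L → Subset n} {P Q} →
    Lift (λ p → Dichotomy (𝓐 p) Q) P → Homogeneous (λ p → AnticompleteToAll (𝓐 p) Q) P →
    Separated G 𝓐 𝓑 P Q
  separated dichotomy (inj₁ anti) =
    (λ p q p∈ q∈ → proj₁ (dichotomy p∈) q∈) , inj₁ λ p q p∈ q∈ → anti p∈ q∈
  separated dichotomy (inj₂ ¬anti) =
    (λ p q p∈ q∈ → proj₁ (dichotomy p∈) q∈) ,
    inj₂ λ p p∈ → let x , x∈ , sees = vertex-of-dichotomy (¬anti p∈) (dichotomy p∈)
                  in x , x∈ , λ q q∈ → sees q∈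

  refine-pair : ∀ {a} (𝓐 : Fin L → Subset n) → (∀ p → ∣ 𝓐 p ∣ ≤ a) →
    ∀ s P Q → pairCost a s ≤ ∣ P ∣ → pairCost a s ≤ ∣ Q ∣ →
    ∃₂ λ P′ Q′ → P′ ⊆ P × Q′ ⊆ Q × s ≤ ∣ P′ ∣ × s ≤ ∣ Q′ ∣ × Separated G 𝓐 𝓑 P′ Q′
  refine-pair {a = a} 𝓐 ∣𝓐∣≤a s P Q P-large Q-large =
    let P₀ , P₀⊆P , ∣P₀∣≡2s = ⊆-ofSize (s + s) P (≤-trans (m≤m+n _ _) P-large)
        Q′ , Q′⊆Q , s≤∣Q′∣ , dichotomy =
          refinable-⋂ (Dichotomy ∘ 𝓐) (dichotomy-hereditary ∘ 𝓐)
            (λ p → dichotomy-refinable (𝓐 p) (∣𝓐∣≤a p)) P₀ s Q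
            (subst (λ e → fold s (dichotomyCost a) e ≤ ∣ Q ∣) (sym ∣P₀∣≡2s) (≤-trans (m≤n+m _ _) Q-large))
        P′ , P′⊆P₀ , s≤∣P′∣ , hom =
          refinable-homogeneous (λ p → Lift? (λ q → anticomplete? G (𝓐 p) (𝓑 q)) Q′) s P₀
            (≤-reflexive (sym ∣P₀∣≡2s))
    in P′ , Q′ , P₀⊆P ∘ P′⊆P₀ , Q′⊆Q , s≤∣P′∣ , s≤∣Q′∣ , separated (dichotomy ∘ P′⊆P₀) hom

-- Handling all ordered pairs of collections in turn

module AllPairs {m} {k : Fin m → ℕ}
  (R : (i j : Fin m) → Subset (k i) → Subset (k j) → Set)
  (R-antitone : ∀ {i j P P′ Q Q′} → P′ ⊆ P → Q′ ⊆ Q → R i j P Q → R i j P′ Q′)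
  {cost : ℕ → ℕ} (cost-inflationary : ∀ s → s ≤ cost s)
  (refine : ∀ {i j} → i ≢ j → ∀ s P Q → cost s ≤ ∣ P ∣ → cost s ≤ ∣ Q ∣ →
            ∃₂ λ P′ Q′ → P′ ⊆ P × Q′ ⊆ Q × s ≤ ∣ P′ ∣ × s ≤ ∣ Q′ ∣ × R i j P′ Q′)
  where

  Family : Set
  Family = (l : Fin m) → Subset (k l)

  update : Family → (i : Fin m) → Subset (k i) → Family
  update S i X l with i ≟ l
  ... | yes refl = X
  ... | no _     = S l

  update-same : ∀ S i X → update S i X i ≡ X
  update-same S i X with i ≟ i
  ... | yes refl = refl
  ... | no i≢i   = ⊥-elim (i≢i refl)

  update-other : ∀ S {i l} X → i ≢ l → update S i X l ≡ S l
  update-other S {i} {l} X i≢l with i ≟ l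
  ... | yes i≡l = ⊥-elim (i≢l i≡l)
  ... | no _    = refl

  update-pointwise : ∀ (P : (l : Fin m) → Subset (k l) → Set) S i X →
    P i X → (∀ l → P l (S l)) → ∀ l → P l (update S i X l)
  update-pointwise P S i X Pi PS l with i ≟ l
  ... | yes refl = Pi
  ... | no _     = PS l

  refine-family : ∀ {i j} → i ≢ j → ∀ s (S : Family) → (∀ l → cost s ≤ ∣ S l ∣) →
    Σ Family λ S′ → (∀ l → S′ l ⊆ S l) × (∀ l → s ≤ ∣ S′ l ∣) × R i j (S′ i) (S′ j)
  refine-family {i} {j} i≢j s S large =
    let P′ , Q′ , P′⊆ , Q′⊆ , s≤∣P′∣ , s≤∣Q′∣ , r = refine i≢j s (S i) (S j) (large i) (large j)
        S₁ = update S j Q′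
    in update S₁ i P′ ,
       update-pointwise (λ l X → X ⊆ S l) S₁ i P′ P′⊆
         (update-pointwise (λ l X → X ⊆ S l) S j Q′ Q′⊆ (λ _ x∈ → x∈)) ,
       update-pointwise (λ l X → s ≤ ∣ X ∣) S₁ i P′ s≤∣P′∣
         (update-pointwise (λ l X → s ≤ ∣ X ∣) S j Q′ s≤∣Q′∣ (λ l → ≤-trans (cost-inflationary s) (large l))) ,
       subst₂ (R i j) (sym (update-same S₁ i P′))
         (sym (trans (update-other S₁ P′ i≢j) (update-same S j Q′))) r

  refine-all : ∀ b (ℓ : List (Fin m × Fin m)) (S : Family) → (∀ l → fold b cost (length ℓ) ≤ ∣ S l ∣) →
    Σ Family λ S′ → (∀ l → S′ l ⊆ S l) × (∀ l → b ≤ ∣ S′ l ∣) ×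
             All (uncurry λ i j → i ≢ j → R i j (S′ i) (S′ j)) ℓ
  refine-all b [] S large = S , (λ _ x∈ → x∈) , large , []
  refine-all b ((i , j) ∷ ℓ) S large with i ≟ j
  ... | yes refl =
    let S′ , S′⊆S , b≤ , rest =
          refine-all b ℓ S (λ l → ≤-trans (cost-inflationary _) (large l))
    in S′ , S′⊆S , b≤ , (λ i≢i → ⊥-elim (i≢i refl)) ∷ rest
  ... | no i≢j =
    let S₁ , S₁⊆S , S₁-large , r = refine-family i≢j _ S large
        S′ , S′⊆S₁ , b≤ , rest = refine-all b ℓ S₁ S₁-large
    in S′ , (λ l → S₁⊆S l ∘ S′⊆S₁ l) , b≤ , (λ _ → R-antitone {P = S₁ i} {Q = S₁ j} (S′⊆S₁ i) (S′⊆S₁ j) r) ∷ rest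

module _ {n m a} (G : Graph n) {k : Fin m → ℕ} (𝓑 : (i : Fin m) → Fin (k i) → Pair n)
  (collection : ∀ i → IsDisjointAPairCollection a (𝓑 i)) where

  open AllPairs (λ i j → Separated G (fstP ∘ 𝓑 i) (sndP ∘ 𝓑 j))
    (λ {i} {j} → separated-antitone {G = G} {𝓐 = fstP ∘ 𝓑 i} {𝓑 = sndP ∘ 𝓑 j})
    (pairCost-inflationary a)
    (λ {i} {j} _ → Separation.refine-pair G (sndP ∘ 𝓑 j) (proj₂ (proj₂ (collection j)))
                     (fstP ∘ 𝓑 i) (proj₁ (proj₂ (collection i))))
    public

lemma3p2 : (a b m : ℕ) → 1 ≤ m →
    ∃ λ (Υ : ℕ) → 1 ≤ Υ ×
      ((n : ℕ) (G : Graph n) (k : Fin m → ℕ)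
       (𝓑 : (i : Fin m) → Fin (k i) → Pair n) →
       (∀ i → IsDisjointAPairCollection a (𝓑 i)) →
       (∀ i → Υ ≤ k i) →
       Σ ((i : Fin m) → Subset (k i)) λ 𝓑′ →
         (∀ i → b ≤ ∣ 𝓑′ i ∣) ×
         (∀ i j → i ≢ j →
           (∀ p q → p ∈ 𝓑′ i → q ∈ 𝓑′ j →
              DisjointSets (fstP (𝓑 i p)) (sndP (𝓑 j q)))
           ×
           ((∀ p q → p ∈ 𝓑′ i → q ∈ 𝓑′ j →
              Anticomplete G (fstP (𝓑 i p)) (sndP (𝓑 j q)))
            ⊎
            (∀ p → p ∈ 𝓑′ i →
              ∃ λ x → x ∈ fstP (𝓑 i p) ×
                (∀ q → q ∈ 𝓑′ j → HasNeighbourIn G x (sndP (𝓑 j q)))))))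
lemma3p2 a b m _ = suc Υ₀ , s≤s z≤n , λ n G k 𝓑 collection large →
  let 𝓑′ , _ , b≤ , separatedPairs = refine-all G 𝓑 collection b pairs (λ _ → ⊤)
        (λ l → subst (Υ₀ ≤_) (sym (∣⊤∣≡n (k l))) (≤-trans (n≤1+n Υ₀) (large l)))
  in 𝓑′ , b≤ , λ i j → All.lookup separatedPairs (∈-cartesianProduct⁺ (∈-allFin i) (∈-allFin j))
  where
  pairs : List (Fin m × Fin m)
  pairs = cartesianProduct (allFin m) (allFin m)

  Υ₀ : ℕ
  Υ₀ = fold b (pairCost a) (length pairs)
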